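{- Let $n\ge 3$ and $k\ge 1$ be integers, and let $c$ be a $k$-coloring of the edges of a complete graph $G$ on at least $2n+1$ vertices such that $G$ contains no monochromatic cycle of length $2n+1$ under $c$. Let $Y,Z\subseteq V(G)$ be disjoint with $|Y|\ge n$ and $|Z|\ge n$, and suppose every edge between $Y$ and $Z$ receives the same color $\beta$. Then no vertex $x\in V(G)\setminus(Y\cup Z)$ has all of its edges to $Y\cup Z$ colored $\beta$. Moreover, if $|Z|\ge n+1$, then no edge of $G[Z]$ is colored $\beta$; similarly, if $|Y|\ge n+1$, then no edge of $G[Y]$ is colored $\beta$.
   Context: $G[A]$ denotes the subgraph induced by a vertex set $A$. A $k$-coloring of the edges is an assignment of one of $k$ colors to each edge (not necessarily a Gallai coloring). -}

module Defs where

open import Data.Nat using (ℕ; suc; _+_; _*_)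
open import Data.Fin using (Fin; zero; suc; inject₁; fromℕ)
open import Function.Definitions using (Injective)
open import Relation.Binary.PropositionalEquality using (_≡_)
open import Data.Product using (Σ; _×_)

-- An edge k-coloring of the complete graph on vertex set Fin N:
-- a symmetric function on ordered pairs; values on the diagonal are irrelevant
-- (only pairs of distinct vertices are edges).
record EdgeColoring (N k : ℕ) : Set where
  field
    col  : Fin N → Fin N → Fin k
    symm : ∀ u v → col u v ≡ col v u
open EdgeColoring public

-- A monochromatic cycle of length (suc m) in color α: an injective sequence of
-- vertices v₀,…,v_m such that consecutive vertices and the closing pair
-- v_m v₀ are joined by edges of color α.
MonoCycle : ∀ {N k} → EdgeColoring N k → (m : ℕ) → Fin k → Set
MonoCycle {N} c m α =
  Σ (Fin (suc m) → Fin N) λ f →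
    Injective _≡_ _≡_ f
    × (∀ (i : Fin m) → col c (f (inject₁ i)) (f (suc i)) ≡ α)
    × (col c (f (fromℕ m)) (f zero) ≡ α)

HasMonoCycle : ∀ {N k} → EdgeColoring N k → ℕ → Set
HasMonoCycle c m = Σ _ λ α → MonoCycle c m α

-- Suppose the disjoint vertex sets Y and Z, of sizes at least n, span a
-- complete bipartite graph in colour β.  Then G already contains a β-cycle
-- of length 2n+1 as soon as one extra β-edge closes an odd cycle:
--   * a vertex x outside Y ∪ Z joined in β to all of Y ∪ Z gives the cycle
--     x, y₀, z₀, y₁, z₁, …, y_{n-1}, z_{n-1}, x;
--   * a β-edge uv inside Z with |Z| ≥ n+1 gives u, v, y₀, z₁, y₁, …, y_{n-1}, u,
--     where z₁, …, z_{n-1} are further vertices of Z − {u, v}.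
-- Both are instances of one construction (alternatingCycle): an apex x
-- followed by the interleaving of n distinct vertices of one side with n
-- distinct vertices of the other, where x is β-adjacent to the first and to
-- the last vertex of this alternating path.
module Submission where

open import Defs
open import Data.Nat using (ℕ; suc; _+_; _*_; _≤_)
open import Data.Fin using (Fin)
open import Data.Fin.Subset using (Subset; _∈_; _∉_; ∣_∣; Empty; _∩_)
open import Data.Product using (_×_)
open import Relation.Binary.PropositionalEquality using (_≡_; _≢_)
open import Relation.Nullary using (¬_)

open import Data.Nat using (zero; s≤s⁻¹)
open import Data.Nat.Properties using (+-suc)
open import Data.Fin using (zero; suc; inject₁; fromℕ)
open import Data.Fin.Subset using (inside; outside; _⊆_; _-_; _─_; ⁅_⁆)
open import Data.Fin.Subset.Properties
  using (x∈p∩q⁺; p─⊥≡p; p─q⊆p; x∈p∧x≢y⇒x∈p-y; x∉⁅y⁆⇒x≢y)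
open import Data.Vec using (_∷_; here; there)
import Data.Vec.Functional as Vector
open import Data.Sum using (_⊎_; inj₁; inj₂; [_,_]′)
import Data.Sum as Sum
open import Data.Sum.Properties using ([,]-map)
open import Data.Product using (Σ; _,_; proj₁; proj₂)
open import Data.Empty using (⊥-elim)
open import Function using (_∘_)
open import Function.Definitions using (Injective)
open import Relation.Binary.PropositionalEquality
  using (refl; sym; trans; cong; subst; subst₂)

-- Doubling by recursion, so that Fin (twice (suc m)) reduces to
-- Fin (suc (suc (twice m))) and cycle positions can be split by pattern
-- matching; it agrees with 2 * m, the form used in the statement.
twice : ℕ → ℕ
twice zero    = zero
twice (suc m) = suc (suc (twice m))

twice≡2* : ∀ m → twice m ≡ 2 * m
twice≡2* zero    = refl
twice≡2* (suc m) = cong suc (trans (cong suc (twice≡2* m)) (sym (+-suc m (m + 0))))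

prepend-injective : ∀ {A : Set} {m} {x : A} {g : Fin m → A} →
  (∀ i → g i ≢ x) → Injective _≡_ _≡_ g → Injective _≡_ _≡_ (x Vector.∷ g)
prepend-injective g≢x g-inj {zero}  {zero}  _  = refl
prepend-injective g≢x g-inj {zero}  {suc j} eq = ⊥-elim (g≢x j (sym eq))
prepend-injective g≢x g-inj {suc i} {zero}  eq = ⊥-elim (g≢x i eq)
prepend-injective g≢x g-inj {suc i} {suc j} eq = cong suc (g-inj eq)

[,]-injective : ∀ {A : Set} {m n} {f : Fin m → A} {g : Fin n → A} →
  Injective _≡_ _≡_ f → Injective _≡_ _≡_ g → (∀ i j → f i ≢ g j) →
  Injective _≡_ _≡_ [ f , g ]′
[,]-injective f-inj g-inj f≢g {inj₁ i} {inj₁ j} eq = cong inj₁ (f-inj eq)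
[,]-injective f-inj g-inj f≢g {inj₂ i} {inj₂ j} eq = cong inj₂ (g-inj eq)
[,]-injective f-inj g-inj f≢g {inj₁ i} {inj₂ j} eq = ⊥-elim (f≢g i j eq)
[,]-injective f-inj g-inj f≢g {inj₂ i} {inj₁ j} eq = ⊥-elim (f≢g j i (sym eq))

record Selection {N : ℕ} (m : ℕ) (p : Subset N) : Set where
  field
    elem     : Fin m → Fin N
    distinct : Injective _≡_ _≡_ elem
    member   : ∀ i → elem i ∈ p
open Selection

x∈p─q⇒x∉q : ∀ {N} {p q : Subset N} {x} → x ∈ p ─ q → x ∉ q
x∈p─q⇒x∉q {p = _ ∷ p} {outside ∷ q} here       ()
x∈p─q⇒x∉q {p = _ ∷ p} {_ ∷ q}       (there x∈) (there x∈q) = x∈p─q⇒x∉q x∈ x∈q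

x∈p-y⇒x≢y : ∀ {N} {p : Subset N} {x y} → x ∈ p - y → x ≢ y
x∈p-y⇒x≢y x∈ = x∉⁅y⁆⇒x≢y (x∈p─q⇒x∉q x∈)

∣p∣≡1+∣p-x∣ : ∀ {N} {p : Subset N} {x} → x ∈ p → ∣ p ∣ ≡ suc ∣ p - x ∣
∣p∣≡1+∣p-x∣ {p = inside ∷ p}  {zero}  here        = cong suc (sym (cong ∣_∣ (p─⊥≡p p)))
∣p∣≡1+∣p-x∣ {p = inside ∷ p}  {suc x} (there x∈p) = cong suc (∣p∣≡1+∣p-x∣ x∈p)
∣p∣≡1+∣p-x∣ {p = outside ∷ p} {suc x} (there x∈p) = ∣p∣≡1+∣p-x∣ x∈p

∣p-x∣-lower : ∀ {N m} {p : Subset N} {x} → x ∈ p → suc m ≤ ∣ p ∣ → m ≤ ∣ p - x ∣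
∣p-x∣-lower {m = m} x∈p h = s≤s⁻¹ (subst (suc m ≤_) (∣p∣≡1+∣p-x∣ x∈p) h)

nonempty : ∀ {N m} (p : Subset N) → suc m ≤ ∣ p ∣ → Σ (Fin N) (_∈ p)
nonempty (inside ∷ p)  _ = zero , here
nonempty (outside ∷ p) h with nonempty p h
... | x , x∈p = suc x , there x∈p

extend : ∀ {N m} {p : Subset N} {v} → v ∈ p → Selection m (p - v) → Selection (suc m) p
extend {p = p} {v} v∈p s = record
  { elem     = v Vector.∷ elem s
  ; distinct = prepend-injective (λ i → x∈p-y⇒x≢y (member s i)) (distinct s)
  ; member   = λ { zero → v∈p ; (suc i) → p─q⊆p p ⁅ v ⁆ (member s i) }
  }

mutual
  select : ∀ {N} m (p : Subset N) → m ≤ ∣ p ∣ → Selection m p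
  select zero    p _ = record { elem = λ () ; distinct = λ { {()} } ; member = λ () }
  select (suc m) p h with nonempty p h
  ... | v , v∈p = proj₁ (selectFrom m v∈p h)

  selectFrom : ∀ {N} m {p : Subset N} {v} → v ∈ p → suc m ≤ ∣ p ∣ →
    Σ (Selection (suc m) p) λ s → elem s zero ≡ v
  selectFrom m {p} {v} v∈p h =
    extend v∈p (select m (p - v) (∣p-x∣-lower v∈p h)) , refl

-- Position j of the interleaving z₀ y₀ z₁ y₁ … of two sequences of length m:
-- inj₁ i stands for zᵢ and inj₂ i for yᵢ.
position : ∀ {m} → Fin (twice m) → Fin m ⊎ Fin m
position {suc m} zero          = inj₁ zero
position {suc m} (suc zero)    = inj₂ zero
position {suc m} (suc (suc j)) = Sum.map suc suc (position j)

index : ∀ {m} → Fin m ⊎ Fin m → Fin (twice m)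
index {suc m} (inj₁ zero)    = zero
index {suc m} (inj₂ zero)    = suc zero
index {suc m} (inj₁ (suc i)) = suc (suc (index (inj₁ i)))
index {suc m} (inj₂ (suc i)) = suc (suc (index (inj₂ i)))

index-position : ∀ {m} (j : Fin (twice m)) → index (position j) ≡ j
index-position {suc m} zero          = refl
index-position {suc m} (suc zero)    = refl
index-position {suc m} (suc (suc j)) with position j | index-position j
... | inj₁ i | eq = cong (λ k → suc (suc k)) eq
... | inj₂ i | eq = cong (λ k → suc (suc k)) eq

position-injective : ∀ {m} → Injective _≡_ _≡_ (position {m})
position-injective {x = j} {j′} eq =
  trans (sym (index-position j)) (trans (cong index eq) (index-position j′))

interleave : ∀ {A : Set} {m} → (Fin m → A) → (Fin m → A) → Fin (twice m) → A
interleave zs ys = [ zs , ys ]′ ∘ position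

interleave-tail : ∀ {A : Set} {m} (zs ys : Fin (suc m) → A) (j : Fin (twice m)) →
  interleave zs ys (suc (suc j)) ≡ interleave (zs ∘ suc) (ys ∘ suc) j
interleave-tail zs ys j = [,]-map (position j)

interleave-last : ∀ {A : Set} m (zs ys : Fin (suc m) → A) →
  interleave zs ys (fromℕ (suc (twice m))) ≡ ys (fromℕ m)
interleave-last zero    zs ys = refl
interleave-last (suc m) zs ys =
  trans (interleave-tail zs ys (fromℕ (suc (twice m)))) (interleave-last m (zs ∘ suc) (ys ∘ suc))

interleave-injective : ∀ {A : Set} {m} {zs ys : Fin m → A} →
  Injective _≡_ _≡_ zs → Injective _≡_ _≡_ ys → (∀ i j → zs i ≢ ys j) →
  Injective _≡_ _≡_ (interleave zs ys)
interleave-injective zs-inj ys-inj zs≢ys eq =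
  position-injective ([,]-injective zs-inj ys-inj zs≢ys eq)

interleave-consecutive : ∀ {A : Set} (R : A → A → Set) {m} (zs ys : Fin (suc m) → A) →
  (∀ i j → R (zs i) (ys j)) → (∀ i j → R (ys i) (zs j)) →
  ∀ (j : Fin (suc (twice m))) → R (interleave zs ys (inject₁ j)) (interleave zs ys (suc j))
interleave-consecutive R zs ys zR _ zero = zR zero zero
interleave-consecutive R {suc m} zs ys zR yR (suc zero) = yR zero (suc zero)
interleave-consecutive R {suc m} zs ys zR yR (suc (suc j)) =
  subst₂ R (sym (interleave-tail zs ys (inject₁ j))) (sym (interleave-tail zs ys (suc j)))
    (interleave-consecutive R (zs ∘ suc) (ys ∘ suc)
      (λ i i′ → zR (suc i) (suc i′)) (λ i i′ → yR (suc i) (suc i′)) j)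

record Biclique {N k} (c : EdgeColoring N k) (β : Fin k) (A B : Subset N) : Set where
  field
    disjoint : ∀ {a} → a ∈ A → a ∉ B
    cross    : ∀ {a b} → a ∈ A → b ∈ B → col c a b ≡ β
open Biclique

module _ {N k} {c : EdgeColoring N k} {β : Fin k} where

  Biclique-swap : ∀ {A B} → Biclique c β A B → Biclique c β B A
  Biclique-swap bc = record
    { disjoint = λ b∈B b∈A → disjoint bc b∈A b∈B
    ; cross    = λ b∈B a∈A → trans (symm c _ _) (cross bc a∈A b∈B)
    }

  Biclique-restrict : ∀ {A A′ B} → A′ ⊆ A → Biclique c β A B → Biclique c β A′ B
  Biclique-restrict A′⊆A bc = record
    { disjoint = disjoint bc ∘ A′⊆A
    ; cross    = cross bc ∘ A′⊆A
    }

  alternatingCycle : ∀ {A B m} → Biclique c β A B → ∀ x → x ∉ A → x ∉ B →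
    (zs : Selection (suc m) A) (ys : Selection (suc m) B) →
    col c x (elem zs zero) ≡ β → col c x (elem ys (fromℕ m)) ≡ β →
    MonoCycle c (twice (suc m)) β
  alternatingCycle {A} {B} {m} bc x x∉A x∉B zs ys x-first x-last =
    x Vector.∷ path , prepend-injective path≢x path-injective , edges , closing
    where
    path : Fin (twice (suc m)) → Fin N
    path = interleave (elem zs) (elem ys)

    path-injective : Injective _≡_ _≡_ path
    path-injective = interleave-injective (distinct zs) (distinct ys)
      (λ i j eq → disjoint bc (member zs i) (subst (_∈ B) (sym eq) (member ys j)))

    path≢x : ∀ j → path j ≢ x
    path≢x j with position j
    ... | inj₁ i = λ eq → x∉A (subst (_∈ A) eq (member zs i))
    ... | inj₂ i = λ eq → x∉B (subst (_∈ B) eq (member ys i))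

    edges : ∀ j → col c ((x Vector.∷ path) (inject₁ j)) (path j) ≡ β
    edges zero    = x-first
    edges (suc j) = interleave-consecutive (λ u v → col c u v ≡ β) (elem zs) (elem ys)
      (λ i i′ → cross bc (member zs i) (member ys i′))
      (λ i i′ → cross (Biclique-swap bc) (member ys i) (member zs i′)) j

    closing : col c (path (fromℕ (suc (twice m)))) x ≡ β
    closing = trans (cong (λ v → col c v x) (interleave-last m (elem zs) (elem ys)))
                    (trans (symm c _ _) x-last)

  commonNeighbourCycle : ∀ {A B} m → Biclique c β A B →
    suc m ≤ ∣ A ∣ → suc m ≤ ∣ B ∣ → ∀ x → x ∉ A → x ∉ B →
    (∀ a → a ∈ A → col c x a ≡ β) → (∀ b → b ∈ B → col c x b ≡ β) →
    MonoCycle c (twice (suc m)) β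
  commonNeighbourCycle {A} {B} m bc ∣A∣≥ ∣B∣≥ x x∉A x∉B x-A x-B =
    alternatingCycle bc x x∉A x∉B zs ys (x-A _ (member zs zero)) (x-B _ (member ys (fromℕ m)))
    where
    zs : Selection (suc m) A
    zs = select (suc m) A ∣A∣≥

    ys : Selection (suc m) B
    ys = select (suc m) B ∣B∣≥

  -- Second consequence: if |A| ≥ m+2, a β-edge uv inside A yields a β-cycle
  -- of length 2(m+1)+1, with apex u and path v y₀ z₁ y₁ … inside (A − u) ∪ B.
  chordCycle : ∀ {A B} m → Biclique c β A B →
    suc (suc m) ≤ ∣ A ∣ → suc m ≤ ∣ B ∣ → ∀ {u v} → u ∈ A → v ∈ A → u ≢ v →
    col c u v ≡ β → MonoCycle c (twice (suc m)) β
  chordCycle {A} {B} m bc ∣A∣≥ ∣B∣≥ {u} {v} u∈A v∈A u≢v uv =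
    alternatingCycle (Biclique-restrict (p─q⊆p A ⁅ u ⁆) bc) u
      (λ u∈A-u → x∈p-y⇒x≢y u∈A-u refl) (disjoint bc u∈A) zs ys
      (subst (λ w → col c u w ≡ β) (sym zs-starts-at-v) uv)
      (cross bc u∈A (member ys (fromℕ m)))
    where
    v∈A-u : v ∈ A - u
    v∈A-u = x∈p∧x≢y⇒x∈p-y v∈A (u≢v ∘ sym)

    ∣A-u∣≥ : suc m ≤ ∣ A - u ∣
    ∣A-u∣≥ = ∣p-x∣-lower u∈A ∣A∣≥

    zs-from-v : Σ (Selection (suc m) (A - u)) λ s → elem s zero ≡ v
    zs-from-v = selectFrom m v∈A-u ∣A-u∣≥

    zs : Selection (suc m) (A - u)
    zs = proj₁ zs-from-v

    zs-starts-at-v : elem zs zero ≡ v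
    zs-starts-at-v = proj₂ zs-from-v

    ys : Selection (suc m) B
    ys = select (suc m) B ∣B∣≥

-- The first claim is commonNeighbourCycle; the claims about β-edges inside
-- Z and inside Y are chordCycle for the biclique read from either side.
lemma1p11 : (n k N : ℕ) → 3 ≤ n → 1 ≤ k → suc (2 * n) ≤ N →
  (c : EdgeColoring N k) →
  -- no monochromatic cycle of length 2n+1 (= suc (2 * n))
  ¬ HasMonoCycle c (2 * n) →
  (Y Z : Subset N) → Empty (Y ∩ Z) → n ≤ ∣ Y ∣ → n ≤ ∣ Z ∣ →
  (β : Fin k) →
  (∀ y z → y ∈ Y → z ∈ Z → col c y z ≡ β) →
  (∀ x → x ∉ Y → x ∉ Z →
     ¬ ((∀ y → y ∈ Y → col c x y ≡ β) × (∀ z → z ∈ Z → col c x z ≡ β)))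
  × (suc n ≤ ∣ Z ∣ → ∀ u v → u ∈ Z → v ∈ Z → u ≢ v → col c u v ≢ β)
  × (suc n ≤ ∣ Y ∣ → ∀ u v → u ∈ Y → v ∈ Y → u ≢ v → col c u v ≢ β)
lemma1p11 (suc m) k N _ _ _ c noCycle Y Z Y∩Z-empty ∣Y∣≥ ∣Z∣≥ β Y-Z =
    (λ x x∉Y x∉Z (x-Y , x-Z) →
       noβCycle (commonNeighbourCycle m YZ ∣Y∣≥ ∣Z∣≥ x x∉Y x∉Z x-Y x-Z))
  , (λ ∣Z∣≥′ u v u∈Z v∈Z u≢v uv →
       noβCycle (chordCycle m (Biclique-swap YZ) ∣Z∣≥′ ∣Y∣≥ u∈Z v∈Z u≢v uv))
  , (λ ∣Y∣≥′ u v u∈Y v∈Y u≢v uv →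
       noβCycle (chordCycle m YZ ∣Y∣≥′ ∣Z∣≥ u∈Y v∈Y u≢v uv))
  where
  YZ : Biclique c β Y Z
  YZ = record
    { disjoint = λ {a} a∈Y a∈Z → Y∩Z-empty (a , x∈p∩q⁺ (a∈Y , a∈Z))
    ; cross    = λ {y} {z} → Y-Z y z
    }

  noβCycle : ¬ MonoCycle c (twice (suc m)) β
  noβCycle cyc = noCycle (β , subst (λ l → MonoCycle c l β) (twice≡2* (suc m)) cyc)
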